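{- Let $k\in\{1,2\}$. Every $k$-neighborly family $F\subseteq S^d$ that is a partition is a total lamination.
   Context: Let $S=\{0,1,\ast\}$ and let $S^d$ be the set of strings of length $d$ over $S$; the symbol $\ast$ is called a joker, and $j(x)$ denotes the number of jokers in $x\in S^d$. For $x,y\in S^d$, $d(x,y)$ is the number of positions $i$ such that one of $x_i,y_i$ is $0$ and the other is $1$. A family $F\subseteq S^d$ is $k$-neighborly if $1\leqslant d(x,y)\leqslant k$ for every two distinct $x,y\in F$. A $k$-neighborly family $F$ is a partition if $\sum_{x\in F}2^{j(x)}=2^d$. For $s\in S$ and $i\in[d]$, $F^{i,s}$ denotes the set of strings in $F$ having symbol $s$ at position $i$. A family $F\subseteq S^d$ is a lamination if it is a partition and $F=F^{i,0}\cup F^{i,1}$ for some $i\in[d]$. For $v\in S^d$ and $i\in[d]$, $v_{ -i}\in S^{d-1}$ is the string obtained by deleting the $i$-th letter of $v$, and $F_{ -i}=\{v_{ -i}:v\in F\}$. Total laminations are defined recursively: for every $d\geqslant 1$, the one-element family $\{\ast\ast\cdots\ast\}\subseteq S^d$ and the full cube $\{0,1\}^d\subseteq S^d$ are total laminations; and a lamination $F\subseteq S^d$ is a total lamination if there is $i\in[d]$ such that $F=F^{i,0}\cup F^{i,1}$ and both $F^{i,0}_{ -i}$ and $F^{i,1}_{ -i}$ are total laminations in $S^{d-1}$. -}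

module Defs where

open import Data.Nat using (ℕ; zero; suc; _+_; _^_; _≤_)
open import Data.Bool using (Bool; true; false)
open import Data.Fin using (Fin)
open import Data.Vec using (Vec; []; _∷_; lookup; removeAt; replicate)
open import Data.List using (List; []; _∷_; map; filterᵇ)
open import Data.Nat.ListAction using (sum)
open import Data.List.Membership.Propositional using (_∈_)
open import Data.List.Relation.Unary.Unique.Propositional using (Unique)
open import Data.Product using (_×_; Σ; ∃)
open import Data.Sum using (_⊎_)
open import Relation.Binary.PropositionalEquality using (_≡_; _≢_)
open import Function.Bundles using (_⇔_)

data Sym : Set where
  𝟎 𝟏 ∗ : Sym

Str : ℕ → Set
Str d = Vec Sym d

-- A family F ⊆ S^d, represented as a duplicate-free list (uniqueness is
-- imposed separately where needed).
Family : ℕ → Set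
Family d = List (Str d)

jokers : ∀ {d} → Str d → ℕ
jokers []        = 0
jokers (∗ ∷ xs)  = suc (jokers xs)
jokers (𝟎 ∷ xs)  = jokers xs
jokers (𝟏 ∷ xs)  = jokers xs

clash : Sym → Sym → ℕ
clash 𝟎 𝟏 = 1
clash 𝟏 𝟎 = 1
clash _ _ = 0

dist : ∀ {d} → Str d → Str d → ℕ
dist []       []       = 0
dist (a ∷ xs) (b ∷ ys) = clash a b + dist xs ys

Neighborly : ∀ {d} → ℕ → Family d → Set
Neighborly k F = ∀ x y → x ∈ F → y ∈ F → x ≢ y → (1 ≤ dist x y) × (dist x y ≤ k)

weight : ∀ {d} → Family d → ℕ
weight F = sum (map (λ x → 2 ^ jokers x) F)

Partition : ∀ {d} → Family d → Set
Partition {d} F = Unique F × (∃ λ k → Neighborly k F) × (weight F ≡ 2 ^ d)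

_==_ : Sym → Sym → Bool
𝟎 == 𝟎 = true
𝟏 == 𝟏 = true
∗ == ∗ = true
_ == _ = false

slice : ∀ {d} → Fin d → Sym → Family d → Family d
slice i s F = filterᵇ (λ x → lookup x i == s) F

sliceDel : ∀ {n} → Fin (suc n) → Sym → Family (suc n) → Family n
sliceDel i s F = map (λ x → removeAt x i) (slice i s F)

Split : ∀ {d} → Fin d → Family d → Set
Split i F = ∀ x → x ∈ F → (lookup x i ≡ 𝟎) ⊎ (lookup x i ≡ 𝟏)

Lamination : ∀ {d} → Family d → Set
Lamination F = Partition F × ∃ λ i → Split i F

Binary : ∀ {d} → Str d → Set
Binary x = jokers x ≡ 0

data TotalLamination : (d : ℕ) → Family d → Set where
  all-joker : ∀ {d} (F : Family d) →
              (∀ x → x ∈ F ⇔ x ≡ replicate d ∗) → TotalLamination d F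
  full-cube : ∀ {d} (F : Family d) →
              (∀ x → x ∈ F ⇔ Binary x) → TotalLamination d F
  laminate  : ∀ {n} (F : Family (suc n)) → Lamination F →
              (i : Fin (suc n)) → Split i F →
              TotalLamination n (sliceDel i 𝟎 F) →
              TotalLamination n (sliceDel i 𝟏 F) →
              TotalLamination (suc n) F

-- Disjoint cells have total weight at most 2^d, so a partition tiles {0,1}^d exactly.
-- Weigh the cells of a tiling F against a cell x ∈ F by ω x y = Σ_{p ∈ y} g_x(p), where g_x
-- is a product of one-letter functions; summing over F gives Σ_p g_x(p), which is 0 unless
-- x is all jokers (impossible if F has two cells).  As ω x x = 1, some y ∈ F has ω x y = -1.
-- Nonzero values of ω x y are (-1)^d(x,y), and a nonzero value forces the jokers of y to lie
-- among those of x; so if x has the fewest jokers and d(x,y) ≤ 2, then x and y are twins: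
-- they differ in one letter only, 0 against 1.  Merging them gives a smaller 2-neighborly
-- partition, so by induction some coordinate carries no joker in any cell.  Splitting along
-- it leaves two 2-neighborly partitions of dimension d - 1, and we recurse.

module Submission where

open import Defs
import Algebra.Properties.CommutativeSemigroup
open import Data.Bool using (Bool; true; false; T; if_then_else_)
open import Data.Empty using (⊥; ⊥-elim)
open import Data.Fin using (Fin; zero; suc)
open import Data.Fin.Properties using (¬Fin0)
open import Data.Integer as ℤ using (ℤ; 0ℤ; 1ℤ; -1ℤ; +≤+)
import Data.Integer.Properties as ℤP
open import Data.List using (List; []; _∷_; _++_; map; length)
open import Data.List.Membership.Propositional using (_∈_; _∉_; find)
open import Data.List.Membership.Propositional.Properties using (∈-∃++; ∈-map⁻; ∈-filter⁻)
open import Data.List.Relation.Binary.Permutation.Propositional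
  using (_↭_; prep; ↭-trans; ↭-sym; ↭⇒↭ₛ)
open import Data.List.Relation.Binary.Permutation.Propositional.Properties
  using (∈-resp-↭; shift; map⁺; ↭-length)
import Data.List.Relation.Binary.Permutation.Setoid.Properties as Permutationₛ
open import Data.List.Relation.Unary.All as All using (All; []; _∷_)
open import Data.List.Relation.Unary.All.Properties as Allₚ using (¬Any⇒All¬)
open import Data.List.Relation.Unary.AllPairs as AllPairs using (AllPairs; []; _∷_)
open import Data.List.Relation.Unary.Any using (here; there; any?)
open import Data.List.Relation.Unary.Unique.Propositional using (Unique)
import Data.List.Relation.Unary.Unique.Propositional.Properties as Uniqueₚ
open import Data.Nat using (ℕ; zero; suc; _+_; _^_; _≤_; _<_; z≤n; s≤s)
open import Data.Nat.Induction using (<-wellFounded)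
open import Data.Nat.ListAction.Properties using (sum-↭)
open import Data.Nat.Properties as ℕP using (≤-refl; +-mono-≤; module ≤-Reasoning)
open import Data.Product as Product using (_×_; _,_; proj₁; proj₂; ∃; ∃₂)
open import Data.Sum as Sum using (_⊎_; inj₁; inj₂; [_,_]′)
open import Data.Unit using (tt)
open import Data.Vec using ([]; _∷_; lookup; removeAt; insertAt; replicate)
import Data.Vec.Properties as Vecₚ
open import Function using (_∘_; id)
open import Function.Bundles using (mk⇔)
open import Induction.WellFounded using (Acc; acc)
open import Relation.Binary.PropositionalEquality
  using (_≡_; _≢_; refl; sym; trans; cong; cong₂; subst; module ≡-Reasoning)
import Relation.Binary.PropositionalEquality.Properties as ≡
open import Relation.Nullary using (contradiction; yes; no)
open import Relation.Nullary.Decidable using (T?)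

open Algebra.Properties.CommutativeSemigroup ℕP.+-commutativeSemigroup
  using (x∙yz≈y∙xz; interchange)
module ℤ+ = Algebra.Properties.CommutativeSemigroup ℤP.+-commutativeSemigroup
open import Data.List.Extrema ℕP.≤-totalOrder
  using (argmin; argmin-sel; f[argmin]≤f[⊤]; f[argmin]≤f[xs])

private
  variable
    d n k : ℕ
    x y z w : Str d
    F : Family d

2^suc : ∀ n → 2 ^ suc n ≡ 2 ^ n + 2 ^ n
2^suc n = cong (2 ^ n +_) (ℕP.+-identityʳ (2 ^ n))

m+n≡o+o⇒m≡o×n≡o : ∀ {m n o} → m ≤ o → n ≤ o → m + n ≡ o + o → m ≡ o × n ≡ o
m+n≡o+o⇒m≡o×n≡o {m} {n} {o} m≤o n≤o e =
  ℕP.≤-antisym m≤o (ℕP.+-cancelʳ-≤ o o m (subst (_≤ m + o) e (ℕP.+-monoʳ-≤ m n≤o))) ,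
  ℕP.≤-antisym n≤o (ℕP.+-cancelˡ-≤ o o n (subst (_≤ o + n) e (ℕP.+-monoˡ-≤ n m≤o)))

Unique-map⁺-injectiveOn : ∀ {A B : Set} (g : A → B) {L : List A} →
  (∀ {u v} → u ∈ L → v ∈ L → g u ≡ g v → u ≡ v) → Unique L → Unique (map g L)
Unique-map⁺-injectiveOn g inj []         = []
Unique-map⁺-injectiveOn g inj (u∉ ∷ L!) =
  Allₚ.map⁺ (All.tabulate λ v∈ gu≡gv → All.lookup u∉ v∈ (inj (here refl) (there v∈) gu≡gv)) ∷
  Unique-map⁺-injectiveOn g (λ u∈ v∈ → inj (there u∈) (there v∈)) L!

∈⇒↭∷ : x ∈ F → ∃ λ G → F ↭ x ∷ G
∈⇒↭∷ x∈ with G₁ , G₂ , refl ← ∈-∃++ x∈ = G₁ ++ G₂ , shift _ G₁ G₂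

∈⇒↭∷∷ : x ∈ F → y ∈ F → x ≢ y → ∃ λ R → F ↭ x ∷ y ∷ R
∈⇒↭∷∷ x∈ y∈ x≢y with G , F↭ ← ∈⇒↭∷ x∈ with ∈-resp-↭ F↭ y∈
... | here y≡x    = contradiction (sym y≡x) x≢y
... | there y∈G with R , G↭ ← ∈⇒↭∷ y∈G = R , ↭-trans F↭ (prep _ G↭)

clash-comm : ∀ a b → clash a b ≡ clash b a
clash-comm 𝟎 𝟎 = refl
clash-comm 𝟎 𝟏 = refl
clash-comm 𝟎 ∗ = refl
clash-comm 𝟏 𝟎 = refl
clash-comm 𝟏 𝟏 = refl
clash-comm 𝟏 ∗ = refl
clash-comm ∗ 𝟎 = refl
clash-comm ∗ 𝟏 = refl
clash-comm ∗ ∗ = refl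

clash-self : ∀ a → clash a a ≡ 0
clash-self 𝟎 = refl
clash-self 𝟏 = refl
clash-self ∗ = refl

dist-comm : (x y : Str d) → dist x y ≡ dist y x
dist-comm []      []      = refl
dist-comm (a ∷ x) (b ∷ y) = cong₂ _+_ (clash-comm a b) (dist-comm x y)

dist-self : (x : Str d) → dist x x ≡ 0
dist-self []      = refl
dist-self (a ∷ x) = trans (cong (_+ dist x x) (clash-self a)) (dist-self x)

dist-∗ⁿ : (y : Str d) → dist (replicate d ∗) y ≡ 0
dist-∗ⁿ []      = refl
dist-∗ⁿ (_ ∷ y) = dist-∗ⁿ y

jokers≤length : (x : Str d) → jokers x ≤ d
jokers≤length []      = z≤n
jokers≤length (𝟎 ∷ x) = ℕP.m≤n⇒m≤1+n (jokers≤length x)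
jokers≤length (𝟏 ∷ x) = ℕP.m≤n⇒m≤1+n (jokers≤length x)
jokers≤length (∗ ∷ x) = s≤s (jokers≤length x)

≡∗ⁿ⊎jokers< : (x : Str d) → x ≡ replicate d ∗ ⊎ jokers x < d
≡∗ⁿ⊎jokers< []      = inj₁ refl
≡∗ⁿ⊎jokers< (𝟎 ∷ x) = inj₂ (s≤s (jokers≤length x))
≡∗ⁿ⊎jokers< (𝟏 ∷ x) = inj₂ (s≤s (jokers≤length x))
≡∗ⁿ⊎jokers< (∗ ∷ x) = Sum.map (cong (∗ ∷_)) s≤s (≡∗ⁿ⊎jokers< x)

2^jokers≡2^d⇒≡∗ⁿ : (x : Str d) → 2 ^ jokers x ≡ 2 ^ d → x ≡ replicate d ∗
2^jokers≡2^d⇒≡∗ⁿ x e with ≡∗ⁿ⊎jokers< x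
... | inj₁ x≡∗ⁿ = x≡∗ⁿ
... | inj₂ j<d  = contradiction e (ℕP.<⇒≢ (ℕP.^-monoʳ-< 2 (s≤s (s≤s z≤n)) j<d))

IsBit : Sym → Set
IsBit s = s ≡ 𝟎 ⊎ s ≡ 𝟏

Neighbors : ℕ → Str d → Str d → Set
Neighbors k u v = 1 ≤ dist u v × dist u v ≤ k

Neighbors-comm : (u v : Str d) → Neighbors k u v → Neighbors k v u
Neighbors-comm u v = subst (λ m → 1 ≤ m × m ≤ _) (dist-comm u v)

Neighborly-mono : ∀ {l} → k ≤ l → Neighborly k F → Neighborly l F
Neighborly-mono k≤l nb u v u∈ v∈ u≢v =
  Product.map id (λ d≤k → ℕP.≤-trans d≤k k≤l) (nb u v u∈ v∈ u≢v)

Disjoint : Family d → Set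
Disjoint = AllPairs (λ u v → 1 ≤ dist u v)

Neighborly⇒Disjoint : (F : Family d) → Unique F → Neighborly k F → Disjoint F
Neighborly⇒Disjoint []      []       _  = []
Neighborly⇒Disjoint (x ∷ F) (x∉ ∷ F!) nb =
  All.tabulate (λ v∈ → proj₁ (nb _ _ (here refl) (there v∈) (All.lookup x∉ v∈))) ∷
  Neighborly⇒Disjoint F F! (λ u v u∈ v∈ → nb u v (there u∈) (there v∈))

-- Volume of disjoint families

-- restrict b F: the cells of F meeting the half-cube {p | p₀ = b} (with false ↔ 0),
-- with the first letter dropped.
meets : Bool → Sym → Bool
meets false 𝟏 = false
meets true  𝟎 = false
meets _     _ = true

restrict : Bool → Family (suc d) → Family d
restrict b []             = []
restrict b ((c ∷ u) ∷ F) = if meets b c then u ∷ restrict b F else restrict b F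

weight-restrict : (F : Family (suc d)) →
                  weight F ≡ weight (restrict false F) + weight (restrict true F)
weight-restrict [] = refl
weight-restrict ((𝟎 ∷ u) ∷ F) rewrite weight-restrict F =
  sym (ℕP.+-assoc (2 ^ jokers u) _ _)
weight-restrict ((𝟏 ∷ u) ∷ F) rewrite weight-restrict F =
  x∙yz≈y∙xz (2 ^ jokers u) (weight (restrict false F)) (weight (restrict true F))
weight-restrict ((∗ ∷ u) ∷ F) rewrite weight-restrict F | 2^suc (jokers u) =
  interchange (2 ^ jokers u) (2 ^ jokers u) (weight (restrict false F)) (weight (restrict true F))

meets⇒clash≡0 : ∀ b c c′ → T (meets b c) → T (meets b c′) → clash c c′ ≡ 0
meets⇒clash≡0 false 𝟎 𝟎 _ _ = refl
meets⇒clash≡0 false 𝟎 ∗ _ _ = refl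
meets⇒clash≡0 false ∗ _ _ _ = refl
meets⇒clash≡0 true  𝟏 𝟏 _ _ = refl
meets⇒clash≡0 true  𝟏 ∗ _ _ = refl
meets⇒clash≡0 true  ∗ _ _ _ = refl
meets⇒clash≡0 false 𝟎 𝟏 _ ()
meets⇒clash≡0 true  𝟏 𝟎 _ ()

All-restrict : ∀ b {c} {u : Str d} (F : Family (suc d)) → T (meets b c) →
               All (λ v → 1 ≤ dist (c ∷ u) v) F → All (λ v → 1 ≤ dist u v) (restrict b F)
All-restrict b []             _ []       = []
All-restrict b {c} ((c′ ∷ v) ∷ F) mc (h ∷ hs) with meets b c′ in eq
... | true  = subst (λ m → 1 ≤ m + _) (meets⇒clash≡0 b c c′ mc (subst T (sym eq) tt)) h ∷
              All-restrict b F mc hs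
... | false = All-restrict b F mc hs

Disjoint-restrict : ∀ b (F : Family (suc d)) → Disjoint F → Disjoint (restrict b F)
Disjoint-restrict b []             []       = []
Disjoint-restrict b ((c ∷ u) ∷ F) (h ∷ hs) with meets b c in eq
... | true  = All-restrict b F (subst T (sym eq) tt) h ∷ Disjoint-restrict b F hs
... | false = Disjoint-restrict b F hs

weight-bound : ∀ d (F : Family d) → Disjoint F → weight F ≤ 2 ^ d
weight-bound zero    []             _                  = z≤n
weight-bound zero    ([] ∷ [])      _                  = ≤-refl
weight-bound zero    ([] ∷ [] ∷ _)  ((() ∷ _) ∷ _)
weight-bound (suc d) F              h                  = begin
  weight F                                              ≡⟨ weight-restrict F ⟩
  weight (restrict false F) + weight (restrict true F)  ≤⟨ +-mono-≤ (bound false) (bound true) ⟩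
  2 ^ d + 2 ^ d                                         ≡⟨ 2^suc d ⟨
  2 ^ suc d                                             ∎
  where
  open ≤-Reasoning
  bound : ∀ b → weight (restrict b F) ≤ 2 ^ d
  bound b = weight-bound d (restrict b F) (Disjoint-restrict b F h)

exact-halves : ∀ {A B : Family d} → Disjoint A → Disjoint B →
               weight A + weight B ≡ 2 ^ suc d → weight A ≡ 2 ^ d × weight B ≡ 2 ^ d
exact-halves {d} {A} {B} dA dB e =
  m+n≡o+o⇒m≡o×n≡o (weight-bound d A dA) (weight-bound d B dB) (trans e (2^suc d))

exact-restrict : (F : Family (suc d)) → Disjoint F → weight F ≡ 2 ^ suc d →
                 weight (restrict false F) ≡ 2 ^ d × weight (restrict true F) ≡ 2 ^ d
exact-restrict F h e =
  exact-halves (Disjoint-restrict false F h) (Disjoint-restrict true F h)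
               (trans (sym (weight-restrict F)) e)

-- The signed kernel ω

-- φ a b = Σ_{p ∈ cell b} g_a(p) for g_𝟎 = (1, -1), g_𝟏 = (-1, 1), g_∗ = (1, 0) on {0, 1}.
φ : Sym → Sym → ℤ
φ 𝟎 𝟎 = 1ℤ
φ 𝟎 𝟏 = -1ℤ
φ 𝟎 ∗ = 0ℤ
φ 𝟏 𝟎 = -1ℤ
φ 𝟏 𝟏 = 1ℤ
φ 𝟏 ∗ = 0ℤ
φ ∗ 𝟎 = 1ℤ
φ ∗ 𝟏 = 0ℤ
φ ∗ ∗ = 1ℤ

φ-∗ : ∀ a → φ a ∗ ≡ φ a 𝟎 ℤ.+ φ a 𝟏
φ-∗ 𝟎 = refl
φ-∗ 𝟏 = refl
φ-∗ ∗ = refl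

φ-self : ∀ a → φ a a ≡ 1ℤ
φ-self 𝟎 = refl
φ-self 𝟏 = refl
φ-self ∗ = refl

φ-values : ∀ a b → φ a b ≡ 0ℤ ⊎ φ a b ≡ -1ℤ ℤ.^ clash a b
φ-values 𝟎 𝟎 = inj₂ refl
φ-values 𝟎 𝟏 = inj₂ refl
φ-values 𝟎 ∗ = inj₁ refl
φ-values 𝟏 𝟎 = inj₂ refl
φ-values 𝟏 𝟏 = inj₂ refl
φ-values 𝟏 ∗ = inj₁ refl
φ-values ∗ 𝟎 = inj₂ refl
φ-values ∗ 𝟏 = inj₁ refl
φ-values ∗ ∗ = inj₂ refl

ω : Str d → Str d → ℤ
ω []      []      = 1ℤ
ω (a ∷ x) (b ∷ y) = φ a b ℤ.* ω x y

ω-self : (x : Str d) → ω x x ≡ 1ℤ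
ω-self []      = refl
ω-self (a ∷ x) = cong₂ ℤ._*_ (φ-self a) (ω-self x)

ω-parity : (x y : Str d) → ω x y ≡ 0ℤ ⊎ ω x y ≡ -1ℤ ℤ.^ dist x y
ω-parity []      []      = inj₂ refl
ω-parity (a ∷ x) (b ∷ y) with φ-values a b | ω-parity x y
... | inj₁ e  | _       = inj₁ (cong (ℤ._* ω x y) e)
... | inj₂ _  | inj₁ e  = inj₁ (trans (cong (φ a b ℤ.*_) e) (ℤP.*-zeroʳ (φ a b)))
... | inj₂ e  | inj₂ e′ =
  inj₂ (trans (cong₂ ℤ._*_ e e′) (sym (ℤP.^-distribˡ-+-* -1ℤ (clash a b) (dist x y))))

-1^-values : ∀ n → -1ℤ ℤ.^ n ≡ 1ℤ ⊎ -1ℤ ℤ.^ n ≡ -1ℤ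
-1^-values zero = inj₁ refl
-1^-values (suc n) with -1^-values n
... | inj₁ e = inj₂ (cong (-1ℤ ℤ.*_) e)
... | inj₂ e = inj₁ (cong (-1ℤ ℤ.*_) e)

ω≢-1⇒0≤ω : (x y : Str d) → ω x y ≢ -1ℤ → 0ℤ ℤ.≤ ω x y
ω≢-1⇒0≤ω x y h with ω-parity x y
... | inj₁ e = ℤP.≤-reflexive (sym e)
... | inj₂ e with -1^-values (dist x y)
...   | inj₁ e′ = subst (0ℤ ℤ.≤_) (sym (trans e e′)) (+≤+ z≤n)
...   | inj₂ e′ = contradiction (trans e e′) h

ω≡-1⇒dist≡1 : (x y : Str d) → ω x y ≡ -1ℤ → dist x y ≤ 2 → dist x y ≡ 1
ω≡-1⇒dist≡1 x y e ≤2 with ω-parity x y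
... | inj₁ e′ with () ← trans (sym e) e′
... | inj₂ e′ = odd (dist x y) ≤2 (trans (sym e′) e)
  where
  odd : ∀ n → n ≤ 2 → -1ℤ ℤ.^ n ≡ -1ℤ → n ≡ 1
  odd 1 _ _ = refl
  odd (suc (suc (suc _))) (s≤s (s≤s ()))

ω-∷≢0 : ∀ a b (x y : Str d) → ω (a ∷ x) (b ∷ y) ≢ 0ℤ → ω x y ≢ 0ℤ
ω-∷≢0 a b x y h e = h (trans (cong (φ a b ℤ.*_) e) (ℤP.*-zeroʳ (φ a b)))

ω-∗ⁿ≢0⇒≡∗ⁿ : (x : Str d) → ω x (replicate d ∗) ≢ 0ℤ → x ≡ replicate d ∗
ω-∗ⁿ≢0⇒≡∗ⁿ []      _ = refl
ω-∗ⁿ≢0⇒≡∗ⁿ (∗ ∷ x) h = cong (∗ ∷_) (ω-∗ⁿ≢0⇒≡∗ⁿ x (ω-∷≢0 ∗ ∗ x _ h))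
ω-∗ⁿ≢0⇒≡∗ⁿ (𝟎 ∷ x) h = contradiction refl h
ω-∗ⁿ≢0⇒≡∗ⁿ (𝟏 ∷ x) h = contradiction refl h

ω≢0⇒jokers≤ : (x y : Str d) → ω x y ≢ 0ℤ → jokers y ≤ jokers x
ω≢0⇒jokers≤ []      []      _ = z≤n
ω≢0⇒jokers≤ (a ∷ x) (b ∷ y) h = step a b h (ω≢0⇒jokers≤ x y (ω-∷≢0 a b x y h))
  where
  step : ∀ a b → ω (a ∷ x) (b ∷ y) ≢ 0ℤ → jokers y ≤ jokers x → jokers (b ∷ y) ≤ jokers (a ∷ x)
  step 𝟎 𝟎 _ le = le
  step 𝟎 𝟏 _ le = le
  step 𝟏 𝟎 _ le = le
  step 𝟏 𝟏 _ le = le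
  step ∗ 𝟎 _ le = ℕP.m≤n⇒m≤1+n le
  step ∗ ∗ _ le = s≤s le
  step 𝟎 ∗ h _  = contradiction refl h
  step 𝟏 ∗ h _  = contradiction refl h
  step ∗ 𝟏 h _  = contradiction refl h

ω≢0⇒dist≡0⇒≡ : (x y : Str d) → ω x y ≢ 0ℤ → jokers x ≤ jokers y → dist x y ≡ 0 → x ≡ y
ω≢0⇒dist≡0⇒≡ []      []      _ _       _ = refl
ω≢0⇒dist≡0⇒≡ (𝟎 ∷ x) (𝟎 ∷ y) h j       e = cong (𝟎 ∷_) (ω≢0⇒dist≡0⇒≡ x y (ω-∷≢0 𝟎 𝟎 x y h) j e)
ω≢0⇒dist≡0⇒≡ (𝟏 ∷ x) (𝟏 ∷ y) h j       e = cong (𝟏 ∷_) (ω≢0⇒dist≡0⇒≡ x y (ω-∷≢0 𝟏 𝟏 x y h) j e)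
ω≢0⇒dist≡0⇒≡ (∗ ∷ x) (∗ ∷ y) h (s≤s j) e = cong (∗ ∷_) (ω≢0⇒dist≡0⇒≡ x y (ω-∷≢0 ∗ ∗ x y h) j e)
ω≢0⇒dist≡0⇒≡ (∗ ∷ x) (𝟎 ∷ y) h j       _ =
  contradiction (ℕP.≤-trans j (ω≢0⇒jokers≤ x y (ω-∷≢0 ∗ 𝟎 x y h))) (ℕP.<-irrefl refl)
ω≢0⇒dist≡0⇒≡ (𝟎 ∷ x) (𝟏 ∷ y) _ _ ()
ω≢0⇒dist≡0⇒≡ (𝟏 ∷ x) (𝟎 ∷ y) _ _ ()
ω≢0⇒dist≡0⇒≡ (𝟎 ∷ x) (∗ ∷ y) h = contradiction refl h
ω≢0⇒dist≡0⇒≡ (𝟏 ∷ x) (∗ ∷ y) h = contradiction refl h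
ω≢0⇒dist≡0⇒≡ (∗ ∷ x) (𝟏 ∷ y) h = contradiction refl h

ωSum : Str d → Family d → ℤ
ωSum x []      = 0ℤ
ωSum x (y ∷ F) = ω x y ℤ.+ ωSum x F

ωSum-restrict : ∀ a (x : Str d) F →
  ωSum (a ∷ x) F ≡ φ a 𝟎 ℤ.* ωSum x (restrict false F) ℤ.+ φ a 𝟏 ℤ.* ωSum x (restrict true F)
ωSum-restrict a x [] = sym (cong₂ ℤ._+_ (ℤP.*-zeroʳ (φ a 𝟎)) (ℤP.*-zeroʳ (φ a 𝟏)))
ωSum-restrict a x ((c ∷ u) ∷ F) = trans (cong (ℤ._+_ (φ a c ℤ.* W)) (ωSum-restrict a x F)) (step c)
  where
  A B W P Q : ℤ
  A = φ a 𝟎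
  B = φ a 𝟏
  W = ω x u
  P = ωSum x (restrict false F)
  Q = ωSum x (restrict true F)
  step : ∀ c → φ a c ℤ.* W ℤ.+ (A ℤ.* P ℤ.+ B ℤ.* Q) ≡
               A ℤ.* ωSum x (restrict false ((c ∷ u) ∷ F)) ℤ.+
               B ℤ.* ωSum x (restrict true ((c ∷ u) ∷ F))
  step 𝟎 = trans (sym (ℤP.+-assoc (A ℤ.* W) (A ℤ.* P) (B ℤ.* Q)))
                 (cong (ℤ._+ B ℤ.* Q) (sym (ℤP.*-distribˡ-+ A W P)))
  step 𝟏 = trans (ℤ+.x∙yz≈y∙xz (B ℤ.* W) (A ℤ.* P) (B ℤ.* Q))
                 (cong (ℤ._+_ (A ℤ.* P)) (sym (ℤP.*-distribˡ-+ B W Q)))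
  step ∗ = begin
    φ a ∗ ℤ.* W ℤ.+ (A ℤ.* P ℤ.+ B ℤ.* Q)
      ≡⟨ cong (λ t → t ℤ.* W ℤ.+ (A ℤ.* P ℤ.+ B ℤ.* Q)) (φ-∗ a) ⟩
    (A ℤ.+ B) ℤ.* W ℤ.+ (A ℤ.* P ℤ.+ B ℤ.* Q)
      ≡⟨ cong (ℤ._+ (A ℤ.* P ℤ.+ B ℤ.* Q)) (ℤP.*-distribʳ-+ W A B) ⟩
    (A ℤ.* W ℤ.+ B ℤ.* W) ℤ.+ (A ℤ.* P ℤ.+ B ℤ.* Q)
      ≡⟨ ℤ+.interchange (A ℤ.* W) (B ℤ.* W) (A ℤ.* P) (B ℤ.* Q) ⟩
    (A ℤ.* W ℤ.+ A ℤ.* P) ℤ.+ (B ℤ.* W ℤ.+ B ℤ.* Q)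
      ≡⟨ cong₂ ℤ._+_ (ℤP.*-distribˡ-+ A W P) (ℤP.*-distribˡ-+ B W Q) ⟨
    A ℤ.* (W ℤ.+ P) ℤ.+ B ℤ.* (W ℤ.+ Q)
      ∎
    where open ≡-Reasoning

ωSum-exact : ∀ d (F : Family d) → Disjoint F → weight F ≡ 2 ^ d →
             ∀ x → ωSum x F ≡ ω x (replicate d ∗)
ωSum-exact zero    []            _              ()
ωSum-exact zero    ([] ∷ [])     _              _ [] = refl
ωSum-exact zero    ([] ∷ [] ∷ _) ((() ∷ _) ∷ _) _
ωSum-exact (suc d) F             h              e (a ∷ x) = begin
  ωSum (a ∷ x) F
    ≡⟨ ωSum-restrict a x F ⟩
  φ a 𝟎 ℤ.* ωSum x F₀ ℤ.+ φ a 𝟏 ℤ.* ωSum x F₁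
    ≡⟨ cong₂ (λ s t → φ a 𝟎 ℤ.* s ℤ.+ φ a 𝟏 ℤ.* t) (IH false e₀) (IH true e₁) ⟩
  φ a 𝟎 ℤ.* ω x ∗ⁿ ℤ.+ φ a 𝟏 ℤ.* ω x ∗ⁿ
    ≡⟨ ℤP.*-distribʳ-+ (ω x ∗ⁿ) (φ a 𝟎) (φ a 𝟏) ⟨
  (φ a 𝟎 ℤ.+ φ a 𝟏) ℤ.* ω x ∗ⁿ
    ≡⟨ cong (ℤ._* ω x ∗ⁿ) (φ-∗ a) ⟨
  φ a ∗ ℤ.* ω x ∗ⁿ
    ∎
  where
  open ≡-Reasoning
  ∗ⁿ : Str d
  ∗ⁿ = replicate d ∗
  F₀ F₁ : Family d
  F₀ = restrict false F
  F₁ = restrict true F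
  e₀ : weight F₀ ≡ 2 ^ d
  e₀ = proj₁ (exact-restrict F h e)
  e₁ : weight F₁ ≡ 2 ^ d
  e₁ = proj₂ (exact-restrict F h e)
  IH : ∀ b → weight (restrict b F) ≡ 2 ^ d → ωSum x (restrict b F) ≡ ω x ∗ⁿ
  IH b eb = ωSum-exact d (restrict b F) (Disjoint-restrict b F h) eb x

ωSum-nonneg : All (λ y → ω x y ≢ -1ℤ) F → 0ℤ ℤ.≤ ωSum x F
ωSum-nonneg         []       = ℤP.≤-refl
ωSum-nonneg {x = x} (h ∷ hs) = ℤP.+-mono-≤ (ω≢-1⇒0≤ω x _ h) (ωSum-nonneg hs)

ωSum-pos : x ∈ F → All (λ y → ω x y ≢ -1ℤ) F → 1ℤ ℤ.≤ ωSum x F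
ωSum-pos {x = x} (here refl) (_ ∷ hs) rewrite ω-self x =
  ℤP.+-mono-≤ (ℤP.≤-refl {1ℤ}) (ωSum-nonneg hs)
ωSum-pos {x = x} (there x∈)  (h ∷ hs) = ℤP.+-mono-≤ (ω≢-1⇒0≤ω x _ h) (ωSum-pos x∈ hs)

data Twins : ∀ {d} → Str d → Str d → Str d → Set where
  here₀₁ : ∀ {d} {v : Str d} → Twins (𝟎 ∷ v) (𝟏 ∷ v) (∗ ∷ v)
  here₁₀ : ∀ {d} {v : Str d} → Twins (𝟏 ∷ v) (𝟎 ∷ v) (∗ ∷ v)
  there  : ∀ {d} c {x y z : Str d} → Twins x y z → Twins (c ∷ x) (c ∷ y) (c ∷ z)

ω≢0⇒dist≡1⇒Twins : (x y : Str d) → ω x y ≢ 0ℤ → jokers x ≤ jokers y → dist x y ≡ 1 →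
                    ∃ (Twins x y)
ω≢0⇒dist≡1⇒Twins []      []      _ _       ()
ω≢0⇒dist≡1⇒Twins (𝟎 ∷ x) (𝟎 ∷ y) h j       e =
  Product.map (𝟎 ∷_) (there 𝟎) (ω≢0⇒dist≡1⇒Twins x y (ω-∷≢0 𝟎 𝟎 x y h) j e)
ω≢0⇒dist≡1⇒Twins (𝟏 ∷ x) (𝟏 ∷ y) h j       e =
  Product.map (𝟏 ∷_) (there 𝟏) (ω≢0⇒dist≡1⇒Twins x y (ω-∷≢0 𝟏 𝟏 x y h) j e)
ω≢0⇒dist≡1⇒Twins (∗ ∷ x) (∗ ∷ y) h (s≤s j) e =
  Product.map (∗ ∷_) (there ∗) (ω≢0⇒dist≡1⇒Twins x y (ω-∷≢0 ∗ ∗ x y h) j e)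
ω≢0⇒dist≡1⇒Twins (𝟎 ∷ x) (𝟏 ∷ y) h j e
  with refl ← ω≢0⇒dist≡0⇒≡ x y (ω-∷≢0 𝟎 𝟏 x y h) j (ℕP.suc-injective e) = _ , here₀₁
ω≢0⇒dist≡1⇒Twins (𝟏 ∷ x) (𝟎 ∷ y) h j e
  with refl ← ω≢0⇒dist≡0⇒≡ x y (ω-∷≢0 𝟏 𝟎 x y h) j (ℕP.suc-injective e) = _ , here₁₀
ω≢0⇒dist≡1⇒Twins (∗ ∷ x) (𝟎 ∷ y) h j       _ =
  contradiction (ℕP.≤-trans j (ω≢0⇒jokers≤ x y (ω-∷≢0 ∗ 𝟎 x y h))) (ℕP.<-irrefl refl)
ω≢0⇒dist≡1⇒Twins (𝟎 ∷ x) (∗ ∷ y) h = contradiction refl h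
ω≢0⇒dist≡1⇒Twins (𝟏 ∷ x) (∗ ∷ y) h = contradiction refl h
ω≢0⇒dist≡1⇒Twins (∗ ∷ x) (𝟏 ∷ y) h = contradiction refl h

Twins-jokers : Twins x y z → jokers y ≡ jokers x × jokers z ≡ suc (jokers x)
Twins-jokers here₀₁     = refl , refl
Twins-jokers here₁₀     = refl , refl
Twins-jokers (there 𝟎 t) = Twins-jokers t
Twins-jokers (there 𝟏 t) = Twins-jokers t
Twins-jokers (there ∗ t) = Product.map (cong suc) (cong suc) (Twins-jokers t)

Twins-weight : Twins x y z → 2 ^ jokers z ≡ 2 ^ jokers x + 2 ^ jokers y
Twins-weight {x = x} t with Twins-jokers t
... | jy , jz rewrite jy | jz = 2^suc (jokers x)

Twins-dist-self : Twins x y z → dist z x ≡ 0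
Twins-dist-self (here₀₁ {v = v}) = dist-self v
Twins-dist-self (here₁₀ {v = v}) = dist-self v
Twins-dist-self (there c t)      = trans (cong (_+ _) (clash-self c)) (Twins-dist-self t)

Twins-dist≤ : Twins x y z → (w : Str d) → dist z w ≤ dist x w
Twins-dist≤ here₀₁      (c ∷ w) = ℕP.m≤n+m _ (clash 𝟎 c)
Twins-dist≤ here₁₀      (c ∷ w) = ℕP.m≤n+m _ (clash 𝟏 c)
Twins-dist≤ (there a t) (c ∷ w) = ℕP.+-monoʳ-≤ (clash a c) (Twins-dist≤ t w)

Twins-dist≡0 : Twins x y z → (w : Str d) → dist z w ≡ 0 → dist x w ≡ 0 ⊎ dist y w ≡ 0
Twins-dist≡0 here₀₁ (𝟎 ∷ w) e = inj₁ e
Twins-dist≡0 here₀₁ (𝟏 ∷ w) e = inj₂ e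
Twins-dist≡0 here₀₁ (∗ ∷ w) e = inj₁ e
Twins-dist≡0 here₁₀ (𝟎 ∷ w) e = inj₂ e
Twins-dist≡0 here₁₀ (𝟏 ∷ w) e = inj₁ e
Twins-dist≡0 here₁₀ (∗ ∷ w) e = inj₁ e
Twins-dist≡0 (there a t) (c ∷ w) e with clash a c
... | zero = Twins-dist≡0 t w e

Twins-Neighbors : Twins x y z → Neighbors k x w → Neighbors k y w → Neighbors k z w
Twins-Neighbors {w = w} t (1≤x , x≤k) (1≤y , _) =
  ℕP.n≢0⇒n>0 (λ e → [ ℕP.<⇒≢ 1≤x ∘ sym , ℕP.<⇒≢ 1≤y ∘ sym ]′ (Twins-dist≡0 t w e)) ,
  ℕP.≤-trans (Twins-dist≤ t w) x≤k

Twins-IsBit : Twins x y z → ∀ i → IsBit (lookup z i) → IsBit (lookup x i) × IsBit (lookup y i)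
Twins-IsBit here₀₁      zero    (inj₁ ())
Twins-IsBit here₀₁      zero    (inj₂ ())
Twins-IsBit here₁₀      zero    (inj₁ ())
Twins-IsBit here₁₀      zero    (inj₂ ())
Twins-IsBit here₀₁      (suc i) b = b , b
Twins-IsBit here₁₀      (suc i) b = b , b
Twins-IsBit (there c t) zero    b = b , b
Twins-IsBit (there c t) (suc i) b = Twins-IsBit t i b

Twins-coordinate : Twins x y z → ∃ λ i → IsBit (lookup x i) × IsBit (lookup y i)
Twins-coordinate here₀₁      = zero , inj₁ refl , inj₂ refl
Twins-coordinate here₁₀      = zero , inj₂ refl , inj₁ refl
Twins-coordinate (there c t) = Product.map suc id (Twins-coordinate t)

Twins-Split : ∀ {i} {R : Family d} → Twins x y z → Split i (z ∷ R) → Split i (x ∷ y ∷ R)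
Twins-Split {i = i} t split _ (here refl)         = proj₁ (Twins-IsBit t i (split _ (here refl)))
Twins-Split {i = i} t split _ (there (here refl)) = proj₂ (Twins-IsBit t i (split _ (here refl)))
Twins-Split         t split v (there (there v∈)) = split v (there v∈)

Twins-Split-pair : Twins x y z → ∃ λ i → Split i (x ∷ y ∷ [])
Twins-Split-pair t with i , x-bit , y-bit ← Twins-coordinate t = i , λ
  { _ (here refl)         → x-bit
  ; _ (there (here refl)) → y-bit
  }

-- Split coordinates of 2-neighborly partitions

record Partition₂ {d} (F : Family d) : Set where
  field
    unique     : Unique F
    neighborly : Neighborly 2 F
    exact      : weight F ≡ 2 ^ d

  disjoint : Disjoint F
  disjoint = Neighborly⇒Disjoint F unique neighborly

∗ⁿ∉ : Unique F → Neighborly k F → 2 ≤ length F → replicate d ∗ ∉ F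
∗ⁿ∉ {F = _ ∷ []} _ _ (s≤s ())
∗ⁿ∉ {F = a ∷ b ∷ _} ((a≢b ∷ _) ∷ _) nb _ ∗ⁿ∈ =
  apart a (here refl) (λ ∗ⁿ≡a → apart b (there (here refl)) (a≢b ∘ trans (sym ∗ⁿ≡a)))
  where
  apart : ∀ v → v ∈ _ → replicate _ ∗ ≢ v → ⊥
  apart v v∈ ne = ℕP.<⇒≢ (proj₁ (nb _ v ∗ⁿ∈ v∈ ne)) (sym (dist-∗ⁿ v))

∃ω≡-1 : Partition₂ F → 2 ≤ length F → x ∈ F → ∃ λ y → y ∈ F × ω x y ≡ -1ℤ
∃ω≡-1 {d} {F} {x} P 2≤ x∈ with any? (λ y → ω x y ℤ.≟ -1ℤ) F
... | yes found = find found
... | no ¬found = contradiction (subst (_∈ F) (ω-∗ⁿ≢0⇒≡∗ⁿ x ω≢0) x∈) (∗ⁿ∉ unique neighborly 2≤)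
  where
  open Partition₂ P
  1≤ω : 1ℤ ℤ.≤ ω x (replicate d ∗)
  1≤ω = subst (1ℤ ℤ.≤_) (ωSum-exact d F disjoint exact x) (ωSum-pos x∈ (¬Any⇒All¬ F ¬found))
  ω≢0 : ω x (replicate d ∗) ≢ 0ℤ
  ω≢0 e with +≤+ () ← subst (1ℤ ℤ.≤_) e 1≤ω

fewest-jokers : (a : Str d) (G : Family d) →
                ∃ λ x → x ∈ a ∷ G × All (λ y → jokers x ≤ jokers y) (a ∷ G)
fewest-jokers a G =
  argmin jokers a G , [ here , there ]′ (argmin-sel jokers a G) ,
  f[argmin]≤f[⊤] {f = jokers} a G ∷ f[argmin]≤f[xs] {f = jokers} a G

Partition₂-twins : Partition₂ F → 2 ≤ length F →
                   ∃₂ λ x y → ∃ λ R → F ↭ x ∷ y ∷ R × ∃ (Twins x y)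
Partition₂-twins {F = F@(a ∷ G)} P 2≤
  with x , x∈ , fewest ← fewest-jokers a G
  with y , y∈ , ω≡-1 ← ∃ω≡-1 P 2≤ x∈ = x , y , proj₁ F↭ , proj₂ F↭ , twins
  where
  open Partition₂ P
  x≢y : x ≢ y
  x≢y refl with () ← trans (sym (ω-self x)) ω≡-1
  F↭ : ∃ λ R → F ↭ x ∷ y ∷ R
  F↭ = ∈⇒↭∷∷ x∈ y∈ x≢y
  ω≢0 : ω x y ≢ 0ℤ
  ω≢0 ω≡0 with () ← trans (sym ω≡-1) ω≡0
  twins : ∃ (Twins x y)
  twins = ω≢0⇒dist≡1⇒Twins x y ω≢0 (All.lookup fewest y∈)
            (ω≡-1⇒dist≡1 x y ω≡-1 (proj₂ (neighborly x y x∈ y∈ x≢y)))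

Partition₂-resp-↭ : {F G : Family d} → F ↭ G → Partition₂ F → Partition₂ G
Partition₂-resp-↭ {d} F↭G P = record
  { unique     = Permutationₛ.Unique-resp-↭ (≡.setoid (Str d)) (↭⇒↭ₛ F↭G) unique
  ; neighborly = λ u v u∈ v∈ → neighborly u v (∈-resp-↭ (↭-sym F↭G) u∈) (∈-resp-↭ (↭-sym F↭G) v∈)
  ; exact      = trans (sym (sum-↭ (map⁺ (λ v → 2 ^ jokers v) F↭G))) exact
  }
  where open Partition₂ P

Partition₂-merge : {R : Family d} → Twins x y z → Partition₂ (x ∷ y ∷ R) → Partition₂ (z ∷ R)
Partition₂-merge {d} {x} {y} {z} {R} t P = record
  { unique     = All.tabulate (λ v∈ z≡v → z∉ (there (there (subst (_∈ R) (sym z≡v) v∈)))) ∷ R!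
  ; neighborly = neighborly′
  ; exact      = begin
      2 ^ jokers z + weight R                  ≡⟨ cong (_+ weight R) (Twins-weight t) ⟩
      (2 ^ jokers x + 2 ^ jokers y) + weight R ≡⟨ ℕP.+-assoc (2 ^ jokers x) _ _ ⟩
      weight (x ∷ y ∷ R)                       ≡⟨ exact ⟩
      2 ^ d                                    ∎
  }
  where
  open Partition₂ P
  open ≡-Reasoning
  x∉ : All (x ≢_) (y ∷ R)
  x∉ = AllPairs.head unique
  y∉ : All (y ≢_) R
  y∉ = AllPairs.head (AllPairs.tail unique)
  R! : Unique R
  R! = AllPairs.tail (AllPairs.tail unique)
  z∉ : z ∉ x ∷ y ∷ R
  z∉ z∈ = ℕP.<⇒≢ (proj₁ (neighborly z x z∈ (here refl) z≢x)) (sym (Twins-dist-self t))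
    where
    z≢x : z ≢ x
    z≢x z≡x = ℕP.1+n≢n (trans (sym (proj₂ (Twins-jokers t))) (cong jokers z≡x))
  neighborly′ : Neighborly 2 (z ∷ R)
  neighborly′ u v (here refl) (here refl) u≢v = contradiction refl u≢v
  neighborly′ u v (here refl) (there v∈) _    =
    Twins-Neighbors t (neighborly x v (here refl) (there (there v∈)) (All.lookup x∉ (there v∈)))
                      (neighborly y v (there (here refl)) (there (there v∈)) (All.lookup y∉ v∈))
  neighborly′ u v (there u∈) (here refl) u≢v  =
    Neighbors-comm v u (neighborly′ v u (here refl) (there u∈) (u≢v ∘ sym))
  neighborly′ u v (there u∈) (there v∈) u≢v  =
    neighborly u v (there (there u∈)) (there (there v∈)) u≢v

Split-resp-↭ : ∀ {i} {F G : Family d} → F ↭ G → Split i G → Split i F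
Split-resp-↭ F↭G split v v∈ = split v (∈-resp-↭ F↭G v∈)

split-coordinate : (F : Family d) → Acc _<_ (length F) → Partition₂ F → 2 ≤ length F →
                   ∃ λ i → Split i F
split-coordinate F (acc smaller) P 2≤
  with x , y , R , F↭ , z , t ← Partition₂-twins P 2≤ =
  Product.map id (Split-resp-↭ F↭) (split F↭ (Partition₂-merge t (Partition₂-resp-↭ F↭ P)))
  where
  split : ∀ {R} → F ↭ x ∷ y ∷ R → Partition₂ (z ∷ R) → ∃ λ i → Split i (x ∷ y ∷ R)
  split {[]}    _  _  = Twins-Split-pair t
  split {_ ∷ _} F↭ P′ = Product.map id (Twins-Split t)
    (split-coordinate _ (smaller (ℕP.≤-reflexive (sym (↭-length F↭)))) P′ (s≤s (s≤s z≤n)))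

==⇒≡ : ∀ {a b} → T (a == b) → a ≡ b
==⇒≡ {𝟎} {𝟎} _ = refl
==⇒≡ {𝟏} {𝟏} _ = refl
==⇒≡ {∗} {∗} _ = refl
==⇒≡ {𝟎} {𝟏} ()
==⇒≡ {𝟎} {∗} ()
==⇒≡ {𝟏} {𝟎} ()
==⇒≡ {𝟏} {∗} ()
==⇒≡ {∗} {𝟎} ()
==⇒≡ {∗} {𝟏} ()

∈-slice⁻ : ∀ {i s} (F : Family d) → x ∈ slice i s F → x ∈ F × lookup x i ≡ s
∈-slice⁻ {i = i} {s} F x∈ = Product.map id ==⇒≡ (∈-filter⁻ (λ v → T? (lookup v i == s)) x∈)

dist-removeAt : (u v : Str (suc n)) (i : Fin (suc n)) →
                dist u v ≡ clash (lookup u i) (lookup v i) + dist (removeAt u i) (removeAt v i)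
dist-removeAt (a ∷ u)     (b ∷ v)     zero    = refl
dist-removeAt (a ∷ a′ ∷ u) (b ∷ b′ ∷ v) (suc i) =
  trans (cong (clash a b +_) (dist-removeAt (a′ ∷ u) (b′ ∷ v) i))
        (x∙yz≈y∙xz (clash a b) (clash (lookup (a′ ∷ u) i) (lookup (b′ ∷ v) i))
                                (dist (removeAt (a′ ∷ u) i) (removeAt (b′ ∷ v) i)))

dist-removeAt-same : (u v : Str (suc n)) (i : Fin (suc n)) → lookup u i ≡ lookup v i →
                     dist (removeAt u i) (removeAt v i) ≡ dist u v
dist-removeAt-same u v i e = sym (begin
  dist u v                                   ≡⟨ dist-removeAt u v i ⟩
  clash (lookup u i) (lookup v i) + dist′    ≡⟨ cong (λ a → clash a (lookup v i) + dist′) e ⟩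
  clash (lookup v i) (lookup v i) + dist′    ≡⟨ cong (_+ dist′) (clash-self (lookup v i)) ⟩
  dist′                                      ∎)
  where
  open ≡-Reasoning
  dist′ : ℕ
  dist′ = dist (removeAt u i) (removeAt v i)

jokers-removeAt : (u : Str (suc n)) (i : Fin (suc n)) → IsBit (lookup u i) →
                  jokers (removeAt u i) ≡ jokers u
jokers-removeAt (𝟎 ∷ u)     zero    _ = refl
jokers-removeAt (𝟏 ∷ u)     zero    _ = refl
jokers-removeAt (∗ ∷ u)     zero    (inj₁ ())
jokers-removeAt (∗ ∷ u)     zero    (inj₂ ())
jokers-removeAt (𝟎 ∷ b ∷ u) (suc i) h = jokers-removeAt (b ∷ u) i h
jokers-removeAt (𝟏 ∷ b ∷ u) (suc i) h = jokers-removeAt (b ∷ u) i h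
jokers-removeAt (∗ ∷ b ∷ u) (suc i) h = cong suc (jokers-removeAt (b ∷ u) i h)

weight-map : ∀ (g : Str d → Str n) (L : Family d) → (∀ {v} → v ∈ L → jokers (g v) ≡ jokers v) →
             weight (map g L) ≡ weight L
weight-map g []      _ = refl
weight-map g (v ∷ L) h = cong₂ (λ j w → 2 ^ j + w) (h (here refl)) (weight-map g L (h ∘ there))

weight-slices : ∀ {i} (F : Family d) → Split i F →
                weight F ≡ weight (slice i 𝟎 F) + weight (slice i 𝟏 F)
weight-slices []      _     = refl
weight-slices {i = i} (x ∷ F) split
  with split x (here refl) | weight-slices F (λ v → split v ∘ there)
... | inj₁ e | IH rewrite e = trans (cong (2 ^ jokers x +_) IH)
  (sym (ℕP.+-assoc (2 ^ jokers x) (weight (slice i 𝟎 F)) (weight (slice i 𝟏 F))))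
... | inj₂ e | IH rewrite e = trans (cong (2 ^ jokers x +_) IH)
  (x∙yz≈y∙xz (2 ^ jokers x) (weight (slice i 𝟎 F)) (weight (slice i 𝟏 F)))

module _ (i : Fin (suc n)) (s : Sym) (F : Family (suc n)) where

  private
    same-letter : ∀ {u v} → u ∈ slice i s F → v ∈ slice i s F → lookup u i ≡ lookup v i
    same-letter u∈ v∈ = trans (proj₂ (∈-slice⁻ F u∈)) (sym (proj₂ (∈-slice⁻ F v∈)))

  sliceDel-unique : Unique F → Unique (sliceDel i s F)
  sliceDel-unique F! = Unique-map⁺-injectiveOn (λ v → removeAt v i) removeAt-injective
    (Uniqueₚ.filter⁺ (λ v → T? (lookup v i == s)) F!)
    where
    removeAt-injective : ∀ {u v} → u ∈ slice i s F → v ∈ slice i s F →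
                         removeAt u i ≡ removeAt v i → u ≡ v
    removeAt-injective {u} {v} u∈ v∈ e = begin
      u                                       ≡⟨ Vecₚ.insertAt-removeAt u i ⟨
      insertAt (removeAt u i) i (lookup u i)  ≡⟨ cong₂ (λ w a → insertAt w i a) e (same-letter u∈ v∈) ⟩
      insertAt (removeAt v i) i (lookup v i)  ≡⟨ Vecₚ.insertAt-removeAt v i ⟩
      v                                       ∎
      where open ≡-Reasoning

  sliceDel-neighborly : Neighborly k F → Neighborly k (sliceDel i s F)
  sliceDel-neighborly {k} nb _ _ u′∈ v′∈ u′≢v′
    with u , u∈ , refl ← ∈-map⁻ (λ v → removeAt v i) u′∈
    with v , v∈ , refl ← ∈-map⁻ (λ v → removeAt v i) v′∈ =
    subst (λ m → 1 ≤ m × m ≤ k) (sym (dist-removeAt-same u v i (same-letter u∈ v∈)))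
          (nb u v (proj₁ (∈-slice⁻ F u∈)) (proj₁ (∈-slice⁻ F v∈))
                  (u′≢v′ ∘ cong (λ w → removeAt w i)))

  weight-sliceDel : IsBit s → weight (sliceDel i s F) ≡ weight (slice i s F)
  weight-sliceDel s-bit = weight-map (λ v → removeAt v i) (slice i s F) λ {v} v∈ →
    jokers-removeAt v i (subst IsBit (sym (proj₂ (∈-slice⁻ F v∈))) s-bit)

Partition₂-sliceDel : ∀ {i s} {F : Family (suc n)} → Partition₂ F → Split i F → IsBit s →
                      Partition₂ (sliceDel i s F)
Partition₂-sliceDel {n} {i} {s} {F} P split s-bit = record
  { unique     = sliceDel-unique i s F unique
  ; neighborly = sliceDel-neighborly i s F neighborly
  ; exact      = [ (λ { refl → proj₁ halves }) , (λ { refl → proj₂ halves }) ]′ s-bit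
  }
  where
  open Partition₂ P
  halves : weight (sliceDel i 𝟎 F) ≡ 2 ^ n × weight (sliceDel i 𝟏 F) ≡ 2 ^ n
  halves = exact-halves (disjoint-sliceDel 𝟎) (disjoint-sliceDel 𝟏) (begin
    weight (sliceDel i 𝟎 F) + weight (sliceDel i 𝟏 F)
      ≡⟨ cong₂ _+_ (weight-sliceDel i 𝟎 F (inj₁ refl)) (weight-sliceDel i 𝟏 F (inj₂ refl)) ⟩
    weight (slice i 𝟎 F) + weight (slice i 𝟏 F)
      ≡⟨ weight-slices F split ⟨
    weight F
      ≡⟨ exact ⟩
    2 ^ suc n ∎)
    where
    open ≡-Reasoning
    disjoint-sliceDel : ∀ s → Disjoint (sliceDel i s F)
    disjoint-sliceDel s = Neighborly⇒Disjoint _ (sliceDel-unique i s F unique)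
                                                (sliceDel-neighborly i s F neighborly)

total-lamination : ∀ d (F : Family d) → Partition₂ F → TotalLamination d F
total-lamination d [] P = contradiction (Partition₂.exact P) (ℕP.<⇒≢ (ℕP.m^n>0 2 d))
total-lamination d (x ∷ []) P = all-joker (x ∷ []) λ v →
  mk⇔ (λ { (here refl) → x≡∗ⁿ }) (λ { refl → here (sym x≡∗ⁿ) })
  where
  x≡∗ⁿ : x ≡ replicate d ∗
  x≡∗ⁿ = 2^jokers≡2^d⇒≡∗ⁿ x (trans (sym (ℕP.+-identityʳ _)) (Partition₂.exact P))
total-lamination zero F@(_ ∷ _ ∷ _) P =
  ⊥-elim (¬Fin0 (proj₁ (split-coordinate F (<-wellFounded (length F)) P (s≤s (s≤s z≤n)))))
total-lamination (suc n) F@(_ ∷ _ ∷ _) P =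
  laminate F ((unique , (2 , neighborly) , exact) , i , split) i split
    (total-lamination n _ (Partition₂-sliceDel P split (inj₁ refl)))
    (total-lamination n _ (Partition₂-sliceDel P split (inj₂ refl)))
  where
  open Partition₂ P
  coordinate : ∃ λ i → Split i F
  coordinate = split-coordinate F (<-wellFounded (length F)) P (s≤s (s≤s z≤n))
  i : Fin (suc n)
  i = proj₁ coordinate
  split : Split i F
  split = proj₂ coordinate

corollary3p5 : (k : ℕ) → (k ≡ 1 ⊎ k ≡ 2) → (d : ℕ) → 1 ≤ d →
    (F : Family d) → Neighborly k F → Partition F →
    TotalLamination d F
corollary3p5 k k∈12 d _ F nb (F! , _ , exact) = total-lamination d F record
  { unique     = F!
  ; neighborly = Neighborly-mono k≤2 nb
  ; exact      = exact
  }
  where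
  k≤2 : k ≤ 2
  k≤2 = [ (λ { refl → s≤s z≤n }) , (λ { refl → ≤-refl }) ]′ k∈12
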